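{- Let $n\ge 3$ and let $k\ge 0$ be an integer. Then $\tau_k(C_n)=\left\lceil \frac{n}{\min\{n,2k+3\}}\right\rceil$, where $C_n$ is the cycle on $n$ vertices. In particular, if $2k+3<n$, then $\tau_k(C_n)=\lceil n/(2k+3)\rceil$.
   Context: For a graph $G$ and $X\subseteq V(G)$, vertices $u,v$ are $(X,k)$-visible if some shortest $(u,v)$-path in $G$ has at most $k$ internal vertices in $X$; $X$ is a mutual $k$-visible set if every pair of distinct vertices of $X$ is $(X,k)$-visible. A mutual $k$-visibility cover of $G$ is a partition of $V(G)$ in which every part is a mutual $k$-visible set in $G$; $\tau_k(G)$ is the minimum number of parts of a mutual $k$-visibility cover of $G$. -}

module Defs where

open import Data.Nat using (ℕ; zero; suc; _+_; _≤_; _/_)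
open import Data.Fin using (Fin; toℕ; _≟_)
open import Relation.Nullary using (yes; no)
open import Data.Bool using (Bool; true; false)
open import Data.List using (List; []; _∷_)
open import Data.Product using (_×_; Σ; ∃; _,_)
open import Data.Sum using (_⊎_)
open import Relation.Binary.PropositionalEquality using (_≡_; _≢_)

record Graph (n : ℕ) : Set₁ where
  field
    Adj : Fin n → Fin n → Set

open Graph public

Cycle : (n : ℕ) → Graph n
Cycle n = record { Adj = λ i j →
      (suc (toℕ i) ≡ toℕ j)
    ⊎ (suc (toℕ j) ≡ toℕ i)
    ⊎ (suc (toℕ i) ≡ n × toℕ j ≡ 0)
    ⊎ (suc (toℕ j) ≡ n × toℕ i ≡ 0) }

data Walk {n : ℕ} (G : Graph n) : Fin n → Fin n → Set where
  here : (v : Fin n) → Walk G v v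
  step : {u w v : Fin n} → Adj G u w → Walk G w v → Walk G u v

len : {n : ℕ} {G : Graph n} {u v : Fin n} → Walk G u v → ℕ
len (here _)   = 0
len (step _ p) = suc (len p)

inner : {n : ℕ} {G : Graph n} {u v : Fin n} → Walk G u v → List (Fin n)
inner (here _) = []
inner (step _ (here _)) = []
inner (step {w = w} _ p@(step _ _)) = w ∷ inner p

IsShortest : {n : ℕ} {G : Graph n} {u v : Fin n} → Walk G u v → Set
IsShortest {G = G} {u} {v} p = (q : Walk G u v) → len p ≤ len q

Subset : ℕ → Set
Subset n = Fin n → Bool

countIn : {n : ℕ} → Subset n → List (Fin n) → ℕ
countIn X [] = 0
countIn X (x ∷ xs) with X x
... | true  = suc (countIn X xs)
... | false = countIn X xs

Visible : {n : ℕ} → Graph n → Subset n → ℕ → Fin n → Fin n → Set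
Visible G X k u v =
  Σ (Walk G u v) λ p → IsShortest p × countIn X (inner p) ≤ k

MutualVisible : {n : ℕ} → Graph n → Subset n → ℕ → Set
MutualVisible G X k =
  (u v : Fin _) → X u ≡ true → X v ≡ true → u ≢ v → Visible G X k u v

part : {n m : ℕ} → (Fin n → Fin m) → Fin m → Subset n
part c i v with c v ≟ i
... | yes _ = true
... | no  _ = false

-- a mutual k-visibility cover of G with exactly m parts: a partition of V(G)
-- into m nonempty parts (given as a surjective labelling), each mutual k-visible
IsCover : {n : ℕ} → Graph n → ℕ → (m : ℕ) → (Fin n → Fin m) → Set
IsCover G k m c =
  ((i : Fin m) → ∃ λ v → c v ≡ i) × ((i : Fin m) → MutualVisible G (part c i) k)

TauIs : {n : ℕ} → Graph n → ℕ → ℕ → Set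
TauIs G k t =
  (Σ (Fin _ → Fin t) λ c → IsCover G k t c)
  × ((m : ℕ) (c : Fin _ → Fin m) → IsCover G k m c → t ≤ m)

-- ceiling division ⌈ a / b ⌉ (b > 0; value 0 for b = 0, unused)
⌈_/_⌉ : ℕ → ℕ → ℕ
⌈ a / zero ⌉  = 0
⌈ a / suc b ⌉ = (a + b) / suc b

-- Vertices u < v of the cycle cut it into the forward arc (u, v) and the backward arc
-- (v, n) ∪ [0, u).  Deleting one vertex from each arc separates u from v, so every
-- (u,v)-walk passes through a whole arc: the shorter of the two arc walks is a shortest
-- path, and u, v are (X,k)-visible as soon as the shorter arc contains at most k vertices
-- of X, while they are not if both arcs contain more than k.
--
-- If |X| ≥ 2k + 4, the first vertex of X and the (k+2)-nd one have at least
-- k + 1 vertices of X on each arc.  So every part of a cover has at most 2k + 3 vertices, and a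
-- cover has at least n / (2k + 3) parts (and at least n / n = 1).
--
-- For t = ⌈n / min(n, 2k + 3)⌉ we have n ≤ (2k + 3) t, and the residue
-- classes modulo t are mutually k-visible.  A class has at most 2k + 3 members.  For two
-- members u and v = u + a t, the forward arc has a t − 1 vertices, a − 1 of them in the class.
-- If it is the shorter arc then 2 a t ≤ n ≤ (2k + 3) t, so a ≤ k + 1.  Otherwise
-- n ≤ 2 a t, so the class has at most 2a members and the backward arc contains no more of
-- them than the forward arc; as the two arcs together contain at most 2k + 1, that is at most k.

module Submission where

open import Defs
open import Data.Nat using (ℕ; _≤_; _+_; _*_; _⊓_)

open import Data.Bool using (Bool; true; false; T)
open import Data.Empty using (⊥-elim)
open import Data.Fin as Fin using (Fin; toℕ; fromℕ<; zero; suc)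
open import Data.Fin.Properties using (toℕ<n; toℕ-injective; toℕ-fromℕ<; fromℕ<-toℕ; nonZeroIndex)
open import Data.List using (List; []; _∷_; _++_; _∷ʳ_; [_]; length; map; reverse)
open import Data.List.Properties
  using (++-assoc; map-++; length-map; unfold-reverse; reverse-++; ∷-injectiveʳ; ∷ʳ-injectiveˡ)
open import Data.List.Membership.Propositional using (_∈_; find)
open import Data.List.Membership.Propositional.Properties using (∈-∃++; ∈-++⁻; ∈-++⁺ˡ; ∈-++⁺ʳ)
open import Data.List.Relation.Binary.Subset.Propositional using (_⊆_)
open import Data.List.Relation.Unary.All as All using (all?)
open import Data.List.Relation.Unary.All.Properties using (¬All⇒Any¬)
open import Data.List.Relation.Unary.Any using (Any; here; there)
open import Data.List.Relation.Unary.Any.Properties using (Any-⊎⁻; map⁺)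
open import Data.List.Relation.Unary.Unique.Propositional using (Unique; []; _∷_)
import Data.List.Relation.Unary.Unique.Propositional.Properties as Unique
open import Data.Nat.Base
open import Data.Nat.DivMod
  using (_%_; _/_; _mod_; m≡m%n+[m/n]*n; m<n⇒m%n≡m; [m+n]%n≡m%n; m%n<n; m<n*o⇒m/o<n)
open import Data.Nat.Properties
open import Data.Nat.Tactic.RingSolver using (solve-∀)
open import Algebra.Properties.CommutativeMonoid.Sum +-0-commutativeMonoid
  using (sum-syntax; ∑-distrib-+; sum-cong-≗)
open import Algebra.Properties.CommutativeSemigroup +-commutativeSemigroup using (x∙yz≈y∙xz)
open import Data.List.Membership.DecPropositional _≟_ using (_∈?_)
open import Data.Product using (Σ; ∃; ∃-syntax; _×_; _,_; proj₁; proj₂)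
open import Data.Sum as Sum using (_⊎_; inj₁; inj₂; [_,_]′)
open import Data.Unit using (tt)
open import Function using (_∘_; _∘₂_)
open import Function.Bundles using (mk⇔)
open import Relation.Binary.Definitions using (tri<; tri≈; tri>)
open import Relation.Binary.PropositionalEquality
  using (_≡_; _≢_; refl; sym; trans; cong; cong₂; subst; subst₂; module ≡-Reasoning)
open import Relation.Nullary using (¬_; yes; no; does)
open import Relation.Nullary.Decidable using (dec-true; dec-false; does-⇔)

-- Counting in lists

𝟙 : Bool → ℕ
𝟙 true  = 1
𝟙 false = 0

count : {A : Set} → (A → Bool) → List A → ℕ
count p []       = 0
count p (x ∷ xs) = 𝟙 (p x) + count p xs

countIn≡count : ∀ {n} (X : Subset n) xs → countIn X xs ≡ count X xs
countIn≡count X []       = refl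
countIn≡count X (x ∷ xs) with X x
... | true  = cong suc (countIn≡count X xs)
... | false = countIn≡count X xs

module _ {A : Set} (p : A → Bool) where

  count-++ : ∀ xs ys → count p (xs ++ ys) ≡ count p xs + count p ys
  count-++ []       ys = refl
  count-++ (x ∷ xs) ys = trans (cong (𝟙 (p x) +_) (count-++ xs ys)) (sym (+-assoc (𝟙 (p x)) _ _))

  count-∷ʳ : ∀ xs x → count p (xs ∷ʳ x) ≡ count p xs + 𝟙 (p x)
  count-∷ʳ xs x = trans (count-++ xs [ x ]) (cong (count p xs +_) (+-identityʳ _))

  count-reverse : ∀ xs → count p (reverse xs) ≡ count p xs
  count-reverse []       = refl
  count-reverse (x ∷ xs) = begin
    count p (reverse (x ∷ xs))      ≡⟨ cong (count p) (unfold-reverse x xs) ⟩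
    count p (reverse xs ∷ʳ x)       ≡⟨ count-∷ʳ (reverse xs) x ⟩
    count p (reverse xs) + 𝟙 (p x)  ≡⟨ cong (_+ 𝟙 (p x)) (count-reverse xs) ⟩
    count p xs + 𝟙 (p x)            ≡⟨ +-comm (count p xs) _ ⟩
    count p (x ∷ xs)                ∎
    where open ≡-Reasoning

  count-mono-⊆ : ∀ {xs ys} → Unique xs → xs ⊆ ys → count p xs ≤ count p ys
  count-mono-⊆ {[]}     _             _     = z≤n
  count-mono-⊆ {x ∷ xs} (x≢xs ∷ uniq) xs⊆ys with as , bs , refl ← ∈-∃++ (xs⊆ys (here refl)) = begin
    𝟙 (p x) + count p xs                 ≤⟨ +-monoʳ-≤ (𝟙 (p x)) (count-mono-⊆ uniq xs⊆as++bs) ⟩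
    𝟙 (p x) + count p (as ++ bs)         ≡⟨ cong (𝟙 (p x) +_) (count-++ as bs) ⟩
    𝟙 (p x) + (count p as + count p bs)  ≡⟨ x∙yz≈y∙xz (𝟙 (p x)) (count p as) (count p bs) ⟩
    count p as + (𝟙 (p x) + count p bs)  ≡⟨ count-++ as (x ∷ bs) ⟨
    count p (as ++ x ∷ bs)               ∎
    where
    open ≤-Reasoning
    xs⊆as++bs : xs ⊆ as ++ bs
    xs⊆as++bs {y} y∈xs with ∈-++⁻ as (xs⊆ys (there y∈xs))
    ... | inj₁ y∈as         = ∈-++⁺ˡ y∈as
    ... | inj₂ (here refl)  = ⊥-elim (All.lookup x≢xs y∈xs refl)
    ... | inj₂ (there y∈bs) = ∈-++⁺ʳ as y∈bs

  count-none : ∀ xs → (∀ {x} → x ∈ xs → p x ≡ false) → count p xs ≡ 0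
  count-none []       _    = refl
  count-none (x ∷ xs) none = cong₂ _+_ (cong 𝟙 (none (here refl))) (count-none xs (none ∘ there))

  count-cong : ∀ {q : A → Bool} xs → (∀ {x} → x ∈ xs → p x ≡ q x) → count p xs ≡ count q xs
  count-cong []       _   = refl
  count-cong (x ∷ xs) p≗q = cong₂ _+_ (cong 𝟙 (p≗q (here refl))) (count-cong xs (p≗q ∘ there))

count-true : {A : Set} (xs : List A) → count (λ _ → true) xs ≡ length xs
count-true []       = refl
count-true (x ∷ xs) = cong suc (count-true xs)

length-mono-⊆ : {A : Set} {xs ys : List A} → Unique xs → xs ⊆ ys → length xs ≤ length ys
length-mono-⊆ {xs = xs} {ys} uniq xs⊆ys =
  subst₂ _≤_ (count-true xs) (count-true ys) (count-mono-⊆ (λ _ → true) uniq xs⊆ys)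

count-map : {A B : Set} (p : B → Bool) (f : A → B) → ∀ xs → count p (map f xs) ≡ count (p ∘ f) xs
count-map p f []       = refl
count-map p f (x ∷ xs) = cong (𝟙 (p (f x)) +_) (count-map p f xs)

range : ℕ → ℕ → List ℕ
range s zero    = []
range s (suc L) = s ∷ range (suc s) L

length-range : ∀ s L → length (range s L) ≡ L
length-range s zero    = refl
length-range s (suc L) = cong suc (length-range (suc s) L)

range-++ : ∀ s L M → range s (L + M) ≡ range s L ++ range (s + L) M
range-++ s zero    M = cong (λ s′ → range s′ M) (sym (+-identityʳ s))
range-++ s (suc L) M = cong (s ∷_) (trans (range-++ (suc s) L M)
                                          (cong (λ s′ → range (suc s) L ++ range s′ M) (sym (+-suc s L))))

range-∷ʳ : ∀ s L → range s (suc L) ≡ range s L ∷ʳ (s + L)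
range-∷ʳ s L = trans (cong (range s) (+-comm 1 L)) (range-++ s L 1)

∈-range⁻ : ∀ {j} s L → j ∈ range s L → s ≤ j × j < s + L
∈-range⁻ s (suc L) (here refl) = ≤-refl , m<m+n s z<s
∈-range⁻ {j} s (suc L) (there j∈) with s<j , j<1+s+L ← ∈-range⁻ (suc s) L j∈ =
  <⇒≤ s<j , subst (j <_) (sym (+-suc s L)) j<1+s+L

range-unique : ∀ s L → Unique (range s L)
range-unique s zero    = []
range-unique s (suc L) =
  All.tabulate (λ j∈ → <⇒≢ (proj₁ (∈-range⁻ (suc s) L j∈))) ∷ range-unique (suc s) L

count-range-split : ∀ (p : ℕ → Bool) L M →
  count p (range 0 (L + suc M)) ≡ count p (range 0 L) + (𝟙 (p L) + count p (range (suc L) M))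
count-range-split p L M = trans (cong (count p) (range-++ 0 L (suc M))) (count-++ p (range 0 L) _)

count-range-mono : ∀ (p : ℕ → Bool) s {L M} → L ≤ M → count p (range s L) ≤ count p (range s M)
count-range-mono p s {L} L≤M with d , refl ← m≤n⇒∃[o]m+o≡n L≤M =
  subst (count p (range s L) ≤_)
        (sym (trans (cong (count p) (range-++ s L d)) (count-++ p (range s L) _)))
        (m≤m+n _ _)

count-range-index : ∀ (p : ℕ → Bool) s L c → c < count p (range s L) →
  ∃[ i ] i < L × count p (range s i) ≡ c × p (s + i) ≡ true
count-range-index p s (suc L) c c< with p s in ps
count-range-index p s (suc L) zero    _  | true = 0 , z<s , refl , trans (cong p (+-identityʳ s)) ps
count-range-index p s (suc L) (suc c) c< | true
  with i , i<L , count≡c , pi ← count-range-index p (suc s) L c (s<s⁻¹ c<) =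
  suc i , s<s i<L , cong₂ (λ b m → 𝟙 b + m) ps count≡c , trans (cong p (+-suc s i)) pi
count-range-index p s (suc L) c c< | false
  with i , i<L , count≡c , pi ← count-range-index p (suc s) L c c< =
  suc i , s<s i<L , cong₂ (λ b m → 𝟙 b + m) ps count≡c , trans (cong p (+-suc s i)) pi

-- Walks

module _ {n : ℕ} {G : Graph n} where

  tailVertices : {u v : Fin n} → Walk G u v → List (Fin n)
  tailVertices (here _)           = []
  tailVertices (step {w = w} _ p) = w ∷ tailVertices p

  _++ʷ_ : {u w v : Fin n} → Walk G u w → Walk G w v → Walk G u v
  here _   ++ʷ q = q
  step e p ++ʷ q = step e (p ++ʷ q)

  tailVertices-++ʷ : {u w v : Fin n} (p : Walk G u w) (q : Walk G w v) →
                     tailVertices (p ++ʷ q) ≡ tailVertices p ++ tailVertices q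
  tailVertices-++ʷ (here _)           q = refl
  tailVertices-++ʷ (step {w = w} e p) q = cong (w ∷_) (tailVertices-++ʷ p q)

  tailVertices-inner : {u v : Fin n} (p : Walk G u v) → 0 < len p → tailVertices p ≡ inner p ∷ʳ v
  tailVertices-inner (step e p) _ = go e p
    where
    go : {u w v : Fin n} (e : Adj G u w) (p : Walk G w v) → tailVertices (step e p) ≡ inner (step e p) ∷ʳ v
    go e          (here _)    = refl
    go {w = w} e (step e′ p) = cong (w ∷_) (go e′ p)

  len≡1+length-inner : {u v : Fin n} → u ≢ v → (p : Walk G u v) → len p ≡ suc (length (inner p))
  len≡1+length-inner u≢v (here _)   = ⊥-elim (u≢v refl)
  len≡1+length-inner u≢v (step e p) = go e p
    where
    go : {u w v : Fin n} (e : Adj G u w) (p : Walk G w v) → len (step e p) ≡ suc (length (inner (step e p)))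
    go e (here _)    = refl
    go e (step e′ p) = cong suc (go e′ p)

  innerℕ : {u v : Fin n} → Walk G u v → List ℕ
  innerℕ p = map toℕ (inner p)

  countIn-inner : {X : Subset n} {Q : ℕ → Bool} → (∀ w → X w ≡ Q (toℕ w)) →
                  {u v : Fin n} (p : Walk G u v) → countIn X (inner p) ≡ count Q (innerℕ p)
  countIn-inner {X} {Q} X≗Q p = begin
    countIn X (inner p)        ≡⟨ countIn≡count X (inner p) ⟩
    count X (inner p)          ≡⟨ count-cong X (inner p) (λ {w} _ → X≗Q w) ⟩
    count (Q ∘ toℕ) (inner p)  ≡⟨ count-map Q toℕ (inner p) ⟨
    count Q (innerℕ p)         ∎
    where open ≡-Reasoning

  innerℕ-from-tailVertices : ∀ {u v : Fin n} {A} → u ≢ v → (p : Walk G u v) →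
                             map toℕ (tailVertices p) ≡ A ∷ʳ toℕ v → innerℕ p ≡ A
  innerℕ-from-tailVertices {u} {v} {A} u≢v p tail≡ = ∷ʳ-injectiveˡ _ _ (begin
    innerℕ p ∷ʳ toℕ v         ≡⟨ map-++ toℕ (inner p) [ v ] ⟨
    map toℕ (inner p ∷ʳ v)    ≡⟨ cong (map toℕ) (tailVertices-inner p 0<len) ⟨
    map toℕ (tailVertices p)  ≡⟨ tail≡ ⟩
    A ∷ʳ toℕ v                ∎)
    where
    open ≡-Reasoning
    0<len : 0 < len p
    0<len = subst (0 <_) (sym (len≡1+length-inner u≢v p)) z<s

  len-via-innerℕ : ∀ {u v : Fin n} {A} → u ≢ v → (p : Walk G u v) → innerℕ p ≡ A →
                   len p ≡ suc (length A)
  len-via-innerℕ u≢v p refl = trans (len≡1+length-inner u≢v p) (cong suc (sym (length-map toℕ (inner p))))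

  visible-along : ∀ {X : Subset n} {Q : ℕ → Bool} {k} → (∀ w → X w ≡ Q (toℕ w)) →
                  ∀ {u v A} (p : Walk G u v) → innerℕ p ≡ A → IsShortest p → count Q A ≤ k →
                  Visible G X k u v
  visible-along X≗Q p refl shortest few = p , shortest , subst (_≤ _) (sym (countIn-inner X≗Q p)) few

  inner-hits-barrier : {A B : Fin n → Set} → (∀ {x y} → Adj G x y → A x → B y ⊎ A y) →
                       {u v : Fin n} (p : Walk G u v) → A u → ¬ A v → ¬ B v → Any B (inner p)
  inner-hits-barrier closed (here _)             Au ¬Av ¬Bv = ⊥-elim (¬Av Au)
  inner-hits-barrier closed (step e (here _))    Au ¬Av ¬Bv = ⊥-elim ([ ¬Bv , ¬Av ]′ (closed e Au))
  inner-hits-barrier closed (step e (step e′ p)) Au ¬Av ¬Bv =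
    [ here , (λ Aw → there (inner-hits-barrier closed (step e′ p) Aw ¬Av ¬Bv)) ]′ (closed e Au)

  module _ (Adj-sym : ∀ {x y} → Adj G x y → Adj G y x) where

    _▷_ : {u v w : Fin n} → Walk G u v → Adj G v w → Walk G u w
    here _    ▷ e = step e (here _)
    step e′ p ▷ e = step e′ (p ▷ e)

    reverseWalk : {u v : Fin n} → Walk G u v → Walk G v u
    reverseWalk (here u)   = here u
    reverseWalk (step e p) = reverseWalk p ▷ Adj-sym e

    len-▷ : {u v w : Fin n} (p : Walk G u v) (e : Adj G v w) → len (p ▷ e) ≡ suc (len p)
    len-▷ (here _)    e = refl
    len-▷ (step e′ p) e = cong suc (len-▷ p e)

    len-reverseWalk : {u v : Fin n} (p : Walk G u v) → len (reverseWalk p) ≡ len p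
    len-reverseWalk (here _)   = refl
    len-reverseWalk (step e p) = trans (len-▷ (reverseWalk p) (Adj-sym e)) (cong suc (len-reverseWalk p))

    tailVertices-▷ : {u v w : Fin n} (p : Walk G u v) (e : Adj G v w) →
                     tailVertices (p ▷ e) ≡ tailVertices p ∷ʳ w
    tailVertices-▷ (here _)            e = refl
    tailVertices-▷ (step {w = x} e′ p) e = cong (x ∷_) (tailVertices-▷ p e)

    vertices-reverseWalk : {u v : Fin n} (p : Walk G u v) →
                           v ∷ tailVertices (reverseWalk p) ≡ reverse (u ∷ tailVertices p)
    vertices-reverseWalk (here _) = refl
    vertices-reverseWalk {u} {v} (step {w = w} e p) = begin
      v ∷ tailVertices (reverseWalk p ▷ Adj-sym e)  ≡⟨ cong (v ∷_) (tailVertices-▷ (reverseWalk p) (Adj-sym e)) ⟩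
      (v ∷ tailVertices (reverseWalk p)) ∷ʳ u       ≡⟨ cong (_∷ʳ u) (vertices-reverseWalk p) ⟩
      reverse (w ∷ tailVertices p) ∷ʳ u             ≡⟨ unfold-reverse u (w ∷ tailVertices p) ⟨
      reverse (u ∷ w ∷ tailVertices p)              ∎
      where open ≡-Reasoning

    inner-reverseWalk : {u v : Fin n} (p : Walk G u v) → inner (reverseWalk p) ≡ reverse (inner p)
    inner-reverseWalk (here _) = refl
    inner-reverseWalk {u} {v} p@(step e q) = ∷ʳ-injectiveˡ _ _ (∷-injectiveʳ (begin
      v ∷ (inner (reverseWalk p) ∷ʳ u)  ≡⟨ cong (v ∷_) (tailVertices-inner (reverseWalk p) 0<len) ⟨
      v ∷ tailVertices (reverseWalk p)  ≡⟨ vertices-reverseWalk p ⟩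
      reverse (u ∷ tailVertices p)      ≡⟨ cong (λ xs → reverse (u ∷ xs)) (tailVertices-inner p z<s) ⟩
      reverse (u ∷ (inner p ∷ʳ v))      ≡⟨ unfold-reverse u (inner p ∷ʳ v) ⟩
      reverse (inner p ∷ʳ v) ∷ʳ u       ≡⟨ cong (_∷ʳ u) (reverse-++ (inner p) [ v ]) ⟩
      v ∷ (reverse (inner p) ∷ʳ u)      ∎))
      where
      open ≡-Reasoning
      0<len : 0 < len (reverseWalk p)
      0<len = subst (0 <_) (sym (len-reverseWalk p)) z<s

    Visible-sym : ∀ {X k u v} → Visible G X k u v → Visible G X k v u
    Visible-sym {X} {k} (p , shortest , few) =
      reverseWalk p ,
      (λ q → subst₂ _≤_ (sym (len-reverseWalk p)) (len-reverseWalk q) (shortest (reverseWalk q))) ,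
      subst (_≤ k) countIn-reverse few
      where
      open ≡-Reasoning
      countIn-reverse : countIn X (inner p) ≡ countIn X (inner (reverseWalk p))
      countIn-reverse = begin
        countIn X (inner p)                ≡⟨ countIn≡count X (inner p) ⟩
        count X (inner p)                  ≡⟨ count-reverse X (inner p) ⟨
        count X (reverse (inner p))        ≡⟨ cong (count X) (inner-reverseWalk p) ⟨
        count X (inner (reverseWalk p))    ≡⟨ countIn≡count X (inner (reverseWalk p)) ⟨
        countIn X (inner (reverseWalk p))  ∎

    MutualVisible-from-< : ∀ {X k} →
      (∀ {u v} → X u ≡ true → X v ≡ true → toℕ u < toℕ v → Visible G X k u v) → MutualVisible G X k
    MutualVisible-from-< visible u v Xu Xv u≢v with <-cmp (toℕ u) (toℕ v)
    ... | tri< u<v _ _ = visible Xu Xv u<v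
    ... | tri≈ _ u≡v _ = ⊥-elim (u≢v (toℕ-injective u≡v))
    ... | tri> _ _ v<u = Visible-sym (visible Xv Xu v<u)

-- Arcs of the cycle

-- Adj (Cycle n) x y unfolds to CycleStep n (toℕ x) (toℕ y); over ℕ the equations can be
-- matched on.
CycleStep : ℕ → ℕ → ℕ → Set
CycleStep n i j = (suc i ≡ j) ⊎ (suc j ≡ i) ⊎ (suc i ≡ n × j ≡ 0) ⊎ (suc j ≡ n × i ≡ 0)

Cycle-sym : ∀ {n} {x y : Fin n} → Adj (Cycle n) x y → Adj (Cycle n) y x
Cycle-sym (inj₁ e)               = inj₂ (inj₁ e)
Cycle-sym (inj₂ (inj₁ e))        = inj₁ e
Cycle-sym (inj₂ (inj₂ (inj₁ e))) = inj₂ (inj₂ (inj₂ e))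
Cycle-sym (inj₂ (inj₂ (inj₂ e))) = inj₂ (inj₂ (inj₁ e))

Between Outside Barrier : ℕ → ℕ → ℕ → Set
Between lo hi j = lo < j × j < hi
Outside lo hi j = j < lo ⊎ hi < j
Barrier lo hi j = lo ≡ j ⊎ hi ≡ j

Between-closed : ∀ {n lo hi i j} → hi < n → CycleStep n i j → Between lo hi i →
                 Barrier lo hi j ⊎ Between lo hi j
Between-closed _ (inj₁ refl) (lo<i , i<hi) with m≤n⇒m<n∨m≡n i<hi
... | inj₁ i+1<hi = inj₂ (m<n⇒m<1+n lo<i , i+1<hi)
... | inj₂ i+1≡hi = inj₁ (inj₂ (sym i+1≡hi))
Between-closed {j = j} _ (inj₂ (inj₁ refl)) (lo<i , i<hi) with m≤n⇒m<n∨m≡n (s≤s⁻¹ lo<i)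
... | inj₁ lo<j = inj₂ (lo<j , <-trans (n<1+n j) i<hi)
... | inj₂ lo≡j = inj₁ (inj₁ lo≡j)
Between-closed hi<n (inj₂ (inj₂ (inj₁ (refl , _)))) (_ , i<hi) = ⊥-elim (<⇒≱ i<hi (s≤s⁻¹ hi<n))
Between-closed _    (inj₂ (inj₂ (inj₂ (_ , refl)))) (() , _)

Outside-closed : ∀ {n lo hi i j} → hi < n → CycleStep n i j → Outside lo hi i →
                 Barrier lo hi j ⊎ Outside lo hi j
Outside-closed _ (inj₁ refl) (inj₁ i<lo) with m≤n⇒m<n∨m≡n i<lo
... | inj₁ i+1<lo = inj₂ (inj₁ i+1<lo)
... | inj₂ i+1≡lo = inj₁ (inj₁ (sym i+1≡lo))
Outside-closed _ (inj₁ refl) (inj₂ hi<i) = inj₂ (inj₂ (m<n⇒m<1+n hi<i))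
Outside-closed {j = j} _ (inj₂ (inj₁ refl)) (inj₁ i<lo) = inj₂ (inj₁ (<-trans (n<1+n j) i<lo))
Outside-closed _ (inj₂ (inj₁ refl)) (inj₂ hi<i) with m≤n⇒m<n∨m≡n (s≤s⁻¹ hi<i)
... | inj₁ hi<j = inj₂ (inj₂ hi<j)
... | inj₂ hi≡j = inj₁ (inj₂ hi≡j)
Outside-closed {lo = lo} _ (inj₂ (inj₂ (inj₁ (_ , refl)))) _ with m≤n⇒m<n∨m≡n (z≤n {lo})
... | inj₁ 0<lo = inj₂ (inj₁ 0<lo)
... | inj₂ 0≡lo = inj₁ (inj₁ (sym 0≡lo))
Outside-closed hi<n (inj₂ (inj₂ (inj₂ (refl , _)))) _ with m≤n⇒m<n∨m≡n (s≤s⁻¹ hi<n)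
... | inj₁ hi<j = inj₂ (inj₂ hi<j)
... | inj₂ hi≡j = inj₁ (inj₂ hi≡j)

upWalk : ∀ {n} L (x y : Fin n) → toℕ x + L ≡ toℕ y →
         Σ (Walk (Cycle n) x y) λ p → map toℕ (tailVertices p) ≡ range (suc (toℕ x)) L
upWalk zero x y x+0≡y with refl ← toℕ-injective (trans (sym (+-identityʳ (toℕ x))) x+0≡y) = here x , refl
upWalk {n} (suc L) x y x+1+L≡y =
  step (inj₁ (sym x′≡x+1)) (proj₁ rest) ,
  cong₂ _∷_ x′≡x+1 (trans (proj₂ rest) (cong (λ i → range (suc i) L) x′≡x+1))
  where
  1+x+L≡y : suc (toℕ x + L) ≡ toℕ y
  1+x+L≡y = trans (sym (+-suc (toℕ x) L)) x+1+L≡y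
  x+1<n : suc (toℕ x) < n
  x+1<n = ≤-<-trans (subst (suc (toℕ x) ≤_) 1+x+L≡y (s≤s (m≤m+n (toℕ x) L))) (toℕ<n y)
  x′ = fromℕ< x+1<n
  x′≡x+1 : toℕ x′ ≡ suc (toℕ x)
  x′≡x+1 = toℕ-fromℕ< x+1<n
  rest = upWalk L x′ y (trans (cong (_+ L) x′≡x+1) 1+x+L≡y)

module Arcs {n : ℕ} (U V : Fin n) {e f : ℕ} (U<V : suc (toℕ U) + e ≡ toℕ V) (V<n : suc (toℕ V) + f ≡ n)
  where

  private
    u = toℕ U
    v = toℕ V

    u<v : u < v
    u<v = subst (suc u ≤_) U<V (m≤m+n (suc u) e)

    v<n : v < n
    v<n = subst (suc v ≤_) V<n (m≤m+n (suc v) f)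

  U≢V : U ≢ V
  U≢V refl = <-irrefl refl u<v

  forwardArc backwardArc : List ℕ
  forwardArc  = range (suc u) e
  backwardArc = range (suc v) f ++ range 0 u

  forwardArc-unique : Unique forwardArc
  forwardArc-unique = range-unique (suc u) e

  backwardArc-unique : Unique backwardArc
  backwardArc-unique = Unique.++⁺ (range-unique (suc v) f) (range-unique 0 u) disjoint
    where
    disjoint : ∀ {j} → ¬ (j ∈ range (suc v) f × j ∈ range 0 u)
    disjoint (j∈₁ , j∈₂) = <-asym (<-trans u<v (proj₁ (∈-range⁻ (suc v) f j∈₁))) (proj₂ (∈-range⁻ 0 u j∈₂))

  forwardWalk : Σ (Walk (Cycle n) U V) λ p → innerℕ p ≡ forwardArc
  forwardWalk =
    p , innerℕ-from-tailVertices U≢V p (trans tail≡ (trans (range-∷ʳ (suc u) e) (cong (forwardArc ∷ʳ_) U<V)))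
    where
    walk = upWalk (suc e) U V (trans (+-suc u e) U<V)
    p = proj₁ walk
    tail≡ = proj₂ walk

  backwardWalk : Σ (Walk (Cycle n) V U) λ p → innerℕ p ≡ backwardArc
  backwardWalk = p , innerℕ-from-tailVertices (U≢V ∘ sym) p tail≡
    where
    last-<n : v + f < n
    last-<n = subst (v + f <_) V<n ≤-refl
    last first : Fin n
    last  = fromℕ< last-<n
    first = fromℕ< (≤-<-trans z≤n v<n)
    first≡0 : toℕ first ≡ 0
    first≡0 = toℕ-fromℕ< (≤-<-trans z≤n v<n)
    wrap : Adj (Cycle n) last first
    wrap = inj₂ (inj₂ (inj₁ (trans (cong suc (toℕ-fromℕ< last-<n)) V<n , first≡0)))
    up₁ = upWalk f V last (sym (toℕ-fromℕ< last-<n))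
    up₂ = upWalk u first U (cong (_+ u) first≡0)
    p = proj₁ up₁ ++ʷ step wrap (proj₁ up₂)
    open ≡-Reasoning
    tail≡ : map toℕ (tailVertices p) ≡ backwardArc ∷ʳ u
    tail≡ = begin
      map toℕ (tailVertices p)
        ≡⟨ cong (map toℕ) (tailVertices-++ʷ (proj₁ up₁) _) ⟩
      map toℕ (tailVertices (proj₁ up₁) ++ first ∷ tailVertices (proj₁ up₂))
        ≡⟨ map-++ toℕ (tailVertices (proj₁ up₁)) _ ⟩
      map toℕ (tailVertices (proj₁ up₁)) ++ toℕ first ∷ map toℕ (tailVertices (proj₁ up₂))
        ≡⟨ cong₂ _++_ (proj₂ up₁) (cong₂ _∷_ first≡0 (trans (proj₂ up₂) (cong (λ i → range (suc i) u) first≡0))) ⟩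
      range (suc v) f ++ range 0 (suc u)
        ≡⟨ cong (range (suc v) f ++_) (range-∷ʳ 0 u) ⟩
      range (suc v) f ++ (range 0 u ∷ʳ u)
        ≡⟨ ++-assoc (range (suc v) f) (range 0 u) [ u ] ⟨
      backwardArc ∷ʳ u
        ∎

  -- Deleting w₁ and w₂ leaves U in the interval (w₂, w₁) if w₂ < U, and in the complement
  -- of [w₁, w₂] if V < w₂; in both cases V lies outside that component.
  arcs-separate : ∀ {w₁ w₂} → w₁ ∈ forwardArc → w₂ ∈ backwardArc → (q : Walk (Cycle n) U V) →
                  w₁ ∈ innerℕ q ⊎ w₂ ∈ innerℕ q
  arcs-separate {w₁} {w₂} w₁∈F w₂∈B q = [ after-v , before-u ]′ (∈-++⁻ (range (suc v) f) w₂∈B)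
    where
    u<w₁ : u < w₁
    u<w₁ = proj₁ (∈-range⁻ (suc u) e w₁∈F)
    w₁<v : w₁ < v
    w₁<v = subst (w₁ <_) U<V (proj₂ (∈-range⁻ (suc u) e w₁∈F))
    cross : (A : ℕ → Set) → (∀ {i j} → CycleStep n i j → A i → Barrier w₁ w₂ j ⊎ A j) →
            A u → ¬ A v → w₂ ≢ v → w₁ ∈ innerℕ q ⊎ w₂ ∈ innerℕ q
    cross A closed Au ¬Av w₂≢v =
      Sum.map map⁺ map⁺ (Any-⊎⁻ (inner-hits-barrier closed q Au ¬Av [ <⇒≢ w₁<v , w₂≢v ]′))
    after-v : w₂ ∈ range (suc v) f → w₁ ∈ innerℕ q ⊎ w₂ ∈ innerℕ q
    after-v w₂∈ = cross (Outside w₁ w₂) (Outside-closed w₂<n) (inj₁ u<w₁)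
                        [ <-asym w₁<v , <-asym v<w₂ ]′ (>⇒≢ v<w₂)
      where
      v<w₂ : v < w₂
      v<w₂ = proj₁ (∈-range⁻ (suc v) f w₂∈)
      w₂<n : w₂ < n
      w₂<n = subst (w₂ <_) V<n (proj₂ (∈-range⁻ (suc v) f w₂∈))
    before-u : w₂ ∈ range 0 u → w₁ ∈ innerℕ q ⊎ w₂ ∈ innerℕ q
    before-u w₂∈ = cross (Between w₂ w₁) (Sum.map₁ Sum.swap ∘₂ Between-closed (<-trans w₁<v v<n))
                         (w₂<u , u<w₁) (<-asym w₁<v ∘ proj₂) (<⇒≢ (<-trans w₂<u u<v))
      where
      w₂<u : w₂ < u
      w₂<u = proj₂ (∈-range⁻ 0 u w₂∈)

  arcs-covered : (q : Walk (Cycle n) U V) → forwardArc ⊆ innerℕ q ⊎ backwardArc ⊆ innerℕ q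
  arcs-covered q with all? (_∈? innerℕ q) forwardArc | all? (_∈? innerℕ q) backwardArc
  ... | yes F⊆ | _      = inj₁ (All.lookup F⊆)
  ... | no _   | yes B⊆ = inj₂ (All.lookup B⊆)
  ... | no F⊈  | no B⊈
    with w₁ , w₁∈F , w₁∉ ← find (¬All⇒Any¬ (_∈? innerℕ q) forwardArc F⊈)
       | w₂ , w₂∈B , w₂∉ ← find (¬All⇒Any¬ (_∈? innerℕ q) backwardArc B⊈)
    = ⊥-elim ([ w₁∉ , w₂∉ ]′ (arcs-separate w₁∈F w₂∈B q))

  walk-length-bound : (q : Walk (Cycle n) U V) →
                      suc (length forwardArc) ≤ len q ⊎ suc (length backwardArc) ≤ len q
  walk-length-bound q = Sum.map (bound forwardArc-unique) (bound backwardArc-unique) (arcs-covered q)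
    where
    bound : ∀ {A} → Unique A → A ⊆ innerℕ q → suc (length A) ≤ len q
    bound {A} uniq A⊆ =
      subst (suc (length A) ≤_) (sym (len-via-innerℕ U≢V q refl)) (s≤s (length-mono-⊆ uniq A⊆))

  module _ {X : Subset n} {Q : ℕ → Bool} (X≗Q : ∀ w → X w ≡ Q (toℕ w)) {k : ℕ} where

    visible-forward : length forwardArc ≤ length backwardArc → count Q forwardArc ≤ k →
                      Visible (Cycle n) X k U V
    visible-forward F≤B = visible-along X≗Q p (proj₂ forwardWalk) shortest
      where
      p = proj₁ forwardWalk
      shortest : IsShortest p
      shortest q = subst (_≤ len q) (sym (len-via-innerℕ U≢V p (proj₂ forwardWalk)))
                         ([ (λ ≤q → ≤q) , ≤-trans (s≤s F≤B) ]′ (walk-length-bound q))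

    visible-backward : length backwardArc ≤ length forwardArc → count Q backwardArc ≤ k →
                       Visible (Cycle n) X k V U
    visible-backward B≤F = visible-along X≗Q p (proj₂ backwardWalk) shortest
      where
      p = proj₁ backwardWalk
      shortest : IsShortest p
      shortest q = subst₂ _≤_ (sym (len-via-innerℕ (U≢V ∘ sym) p (proj₂ backwardWalk)))
                              (len-reverseWalk Cycle-sym q)
                              ([ ≤-trans (s≤s B≤F) , (λ ≤q → ≤q) ]′ (walk-length-bound (reverseWalk Cycle-sym q)))

    Visible⇒arc-count≤k : Visible (Cycle n) X k U V → count Q forwardArc ≤ k ⊎ count Q backwardArc ≤ k
    Visible⇒arc-count≤k (p , _ , few) =
      Sum.map (bound forwardArc-unique) (bound backwardArc-unique) (arcs-covered p)
      where
      bound : ∀ {A} → Unique A → A ⊆ innerℕ p → count Q A ≤ k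
      bound uniq A⊆ = ≤-trans (count-mono-⊆ Q uniq A⊆) (subst (_≤ k) (countIn-inner X≗Q p) few)

  count-range-around : (Q : ℕ → Bool) → Q u ≡ true → Q v ≡ true →
                       count Q (range 0 n) ≡ 2 + (count Q forwardArc + count Q backwardArc)
  count-range-around Q Qu Qv = begin
    count Q (range 0 n)                          ≡⟨ cong (count Q ∘ range 0) n≡v+1+f ⟩
    count Q (range 0 (v + suc f))                ≡⟨ count-range-split Q v f ⟩
    count Q (range 0 v) + (𝟙 (Q v) + c₁)         ≡⟨ cong₂ (λ c b → c + (𝟙 b + c₁)) c≡ Qv ⟩
    c₀ + (1 + cF) + (1 + c₁)                     ≡⟨ rearrange c₀ cF c₁ ⟩
    2 + (cF + (c₁ + c₀))                         ≡⟨ cong (λ c → 2 + (cF + c)) (count-++ Q (range (suc v) f) (range 0 u)) ⟨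
    2 + (cF + count Q backwardArc)                ∎
    where
    open ≡-Reasoning
    c₀ = count Q (range 0 u)
    c₁ = count Q (range (suc v) f)
    cF = count Q forwardArc
    n≡v+1+f : n ≡ v + suc f
    n≡v+1+f = sym (trans (+-suc v f) V<n)
    c≡ : count Q (range 0 v) ≡ c₀ + (1 + cF)
    c≡ = begin
      count Q (range 0 v)            ≡⟨ cong (count Q ∘ range 0) (sym (trans (+-suc u e) U<V)) ⟩
      count Q (range 0 (u + suc e))  ≡⟨ count-range-split Q u e ⟩
      c₀ + (𝟙 (Q u) + cF)            ≡⟨ cong (λ b → c₀ + (𝟙 b + cF)) Qu ⟩
      c₀ + (1 + cF)                  ∎
    rearrange : ∀ a b c → a + (1 + b) + (1 + c) ≡ 2 + (b + (c + a))
    rearrange = solve-∀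

  n≡2+arcs : n ≡ 2 + (length forwardArc + length backwardArc)
  n≡2+arcs = begin
    n                                                                 ≡⟨ length-range 0 n ⟨
    length (range 0 n)                                                ≡⟨ count-true (range 0 n) ⟨
    count (λ _ → true) (range 0 n)                                    ≡⟨ count-range-around (λ _ → true) refl refl ⟩
    2 + (count (λ _ → true) forwardArc + count (λ _ → true) backwardArc)
      ≡⟨ cong₂ (λ a b → 2 + (a + b)) (count-true forwardArc) (count-true backwardArc) ⟩
    2 + (length forwardArc + length backwardArc)                      ∎
    where open ≡-Reasoning

-- Mutually k-visible sets have at most 2k + 3 vertices

liftSubset : ∀ {n} → Subset n → ℕ → Bool
liftSubset {n} X j with j <? n
... | yes j<n = X (fromℕ< j<n)
... | no  _   = false

liftSubset-toℕ : ∀ {n} (X : Subset n) w → X w ≡ liftSubset X (toℕ w)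
liftSubset-toℕ {n} X w with toℕ w <? n
... | yes w<n = cong X (sym (fromℕ<-toℕ w w<n))
... | no  w≮n = ⊥-elim (w≮n (toℕ<n w))

size : ∀ {n} → Subset n → ℕ
size {n} X = count (liftSubset X) (range 0 n)

vertex : ∀ {n j} → j < n → ∃[ J ] toℕ {n} J ≡ j
vertex j<n = fromℕ< j<n , toℕ-fromℕ< j<n

many-marked-after-first : ∀ (Q : ℕ → Bool) k u g → 2 * k + 3 < count Q (range 0 (suc u + g)) →
                          count Q (range 0 u) ≡ 0 → Q u ≡ true → suc k < count Q (range (suc u) g)
many-marked-after-first Q k u g many none-before Qu =
  ≤-trans k+2≤2k+3 (s≤s⁻¹ (subst (2 * k + 3 <_) total≡ many))
  where
  total≡ : count Q (range 0 (suc u + g)) ≡ suc (count Q (range (suc u) g))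
  total≡ = trans (cong (count Q ∘ range 0) (sym (+-suc u g)))
                 (trans (count-range-split Q u g)
                        (cong₂ (λ c b → c + (𝟙 b + count Q (range (suc u) g))) none-before Qu))
  k+2≤2k+3 : suc (suc k) ≤ 2 * k + 3
  k+2≤2k+3 = subst (suc (suc k) ≤_) (sym (2k+3≡ k)) (s≤s (s≤s (m≤m+n k (k + 1))))
    where
    2k+3≡ : ∀ k → 2 * k + 3 ≡ suc (suc (k + (k + 1)))
    2k+3≡ = solve-∀

marked-pair-k+1-apart : ∀ (Q : ℕ → Bool) n k → 2 * k + 3 < count Q (range 0 n) →
  ∃[ U ] ∃[ V ] ∃[ e ] ∃[ f ] suc (toℕ {n} U) + e ≡ toℕ V × suc (toℕ V) + f ≡ n ×
    Q (toℕ U) ≡ true × Q (toℕ V) ≡ true × count Q (range (suc (toℕ U)) e) ≡ suc k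
marked-pair-k+1-apart Q n k many
  with u , u<n , none-before , Qu ← count-range-index Q 0 n 0 (≤-<-trans z≤n many)
  with U , refl ← vertex u<n
  with g , n≡ ← m≤n⇒∃[o]m+o≡n u<n
  with e , e<g , between≡ , Qv ← count-range-index Q (suc (toℕ U)) g (suc k)
         (many-marked-after-first Q k (toℕ U) g (subst (λ m → 2 * k + 3 < count Q (range 0 m)) (sym n≡) many)
                                  none-before Qu)
  with f , g≡ ← m≤n⇒∃[o]m+o≡n e<g
  with V , V≡ ← vertex (subst (suc (toℕ U) + e <_) n≡ (+-monoʳ-< (suc (toℕ U)) e<g))
  = U , V , e , f , sym V≡ , V<n , Qu , trans (cong Q V≡) Qv , between≡
  where
  V<n : suc (toℕ V) + f ≡ n
  V<n = begin
    suc (toℕ V) + f              ≡⟨ cong (λ i → suc i + f) V≡ ⟩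
    suc (suc (toℕ U) + e) + f    ≡⟨ +-assoc (suc (suc (toℕ U))) e f ⟩
    suc (suc (toℕ U)) + (e + f)  ≡⟨ cong suc (+-suc (toℕ U) (e + f)) ⟨
    suc (toℕ U) + (suc e + f)    ≡⟨ cong (suc (toℕ U) +_) g≡ ⟩
    suc (toℕ U) + g              ≡⟨ n≡ ⟩
    n                            ∎
    where open ≡-Reasoning

MutualVisible⇒size≤2k+3 : ∀ {n} {X : Subset n} {k} → MutualVisible (Cycle n) X k → size X ≤ 2 * k + 3
MutualVisible⇒size≤2k+3 {n} {X} {k} mv = ≮⇒≥ too-many
  where
  Q = liftSubset X
  too-many : ¬ (2 * k + 3 < size X)
  too-many many with U , V , e , f , U<V , V<n , QU , QV , between≡ ← marked-pair-k+1-apart Q n k many =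
    [ (λ F≤k → 1+n≰n (subst (_≤ k) between≡ F≤k)) , (λ B≤k → <⇒≱ many (size≤ B≤k)) ]′
      (Visible⇒arc-count≤k (liftSubset-toℕ X)
         (mv U V (trans (liftSubset-toℕ X U) QU) (trans (liftSubset-toℕ X V) QV) U≢V))
    where
    open Arcs U V U<V V<n
    size≤ : count Q backwardArc ≤ k → size X ≤ 2 * k + 3
    size≤ B≤k = begin
      size X                                       ≡⟨ count-range-around Q QU QV ⟩
      2 + (count Q forwardArc + count Q backwardArc) ≤⟨ +-monoʳ-≤ 2 (+-mono-≤ (≤-reflexive between≡) B≤k) ⟩
      2 + (suc k + k)                              ≡⟨ 2k+3≡ k ⟩
      2 * k + 3                                    ∎
      where
      open ≤-Reasoning
      2k+3≡ : ∀ k → 2 + (suc k + k) ≡ 2 * k + 3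
      2k+3≡ = solve-∀

∑-≤ : ∀ {m B} (g : Fin m → ℕ) → (∀ i → g i ≤ B) → ∑[ i < m ] g i ≤ m * B
∑-≤ {zero}  g g≤B = z≤n
∑-≤ {suc m} g g≤B = +-mono-≤ (g≤B zero) (∑-≤ (g ∘ suc) (g≤B ∘ suc))

∑-zero : ∀ m → ∑[ i < m ] 0 ≡ 0
∑-zero zero    = refl
∑-zero (suc m) = ∑-zero m

∑-𝟙-≟ : ∀ {m} (x : Fin m) → ∑[ i < m ] 𝟙 (does (x Fin.≟ i)) ≡ 1
∑-𝟙-≟ {suc m} zero    = cong suc (∑-zero m)
∑-𝟙-≟ {suc m} (suc x) = ∑-𝟙-≟ x

∑-count-partition : ∀ {A : Set} {m} (P : Fin m → A → Bool) xs →
  (∀ {x} → x ∈ xs → ∑[ i < m ] 𝟙 (P i x) ≡ 1) → ∑[ i < m ] count (P i) xs ≡ length xs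
∑-count-partition {m = m} P []       _           = ∑-zero m
∑-count-partition {m = m} P (x ∷ xs) exactly-one = begin
  ∑[ i < m ] (𝟙 (P i x) + count (P i) xs)
    ≡⟨ ∑-distrib-+ (λ i → 𝟙 (P i x)) (λ i → count (P i) xs) ⟩
  ∑[ i < m ] 𝟙 (P i x) + ∑[ i < m ] count (P i) xs
    ≡⟨ cong₂ _+_ (exactly-one (here refl)) (∑-count-partition P xs (exactly-one ∘ there)) ⟩
  suc (length xs)
    ∎
  where open ≡-Reasoning

part-does : ∀ {n m} (c : Fin n → Fin m) i v → part c i v ≡ does (c v Fin.≟ i)
part-does c i v with c v Fin.≟ i
... | yes _ = refl
... | no  _ = refl

cover⇒n≤m*[2k+3] : ∀ {n k m} {c : Fin n → Fin m} → IsCover (Cycle n) k m c → n ≤ m * (2 * k + 3)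
cover⇒n≤m*[2k+3] {n} {k} {m} {c} (_ , visible) = begin
  n                                 ≡⟨ length-range 0 n ⟨
  length (range 0 n)                ≡⟨ ∑-count-partition (λ i → liftSubset (part c i)) (range 0 n) one-part ⟨
  ∑[ i < m ] size (part c i)        ≤⟨ ∑-≤ _ (λ i → MutualVisible⇒size≤2k+3 (visible i)) ⟩
  m * (2 * k + 3)                   ∎
  where
  open ≤-Reasoning
  one-part : ∀ {j} → j ∈ range 0 n → ∑[ i < m ] 𝟙 (liftSubset (part c i) j) ≡ 1
  one-part j∈ with J , refl ← vertex (proj₂ (∈-range⁻ 0 n j∈)) =
    trans (sum-cong-≗ (λ i → cong 𝟙 (trans (sym (liftSubset-toℕ (part c i) J)) (part-does c i J))))
          (∑-𝟙-≟ (c J))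

cover⇒n≤m*[n⊓[2k+3]] : ∀ {n k m} {c : Fin n → Fin m} → 0 < n → IsCover (Cycle n) k m c →
                       n ≤ m * (n ⊓ (2 * k + 3))
cover⇒n≤m*[n⊓[2k+3]] {n} {k} {m} {c} 0<n cover = begin
  n                            ≤⟨ ⊓-glb (m≤n*m n m) (cover⇒n≤m*[2k+3] cover) ⟩
  (m * n) ⊓ (m * (2 * k + 3))  ≡⟨ *-distribˡ-⊓ m n (2 * k + 3) ⟨
  m * (n ⊓ (2 * k + 3))        ∎
  where
  open ≤-Reasoning
  instance
    m-nonZero : NonZero m
    m-nonZero = nonZeroIndex (c (fromℕ< 0<n))

-- Residue classes are mutually k-visible

2[1+x]≤2k+3⇒x≤k : ∀ {x k} → 2 * suc x ≤ 2 * k + 3 → x ≤ k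
2[1+x]≤2k+3⇒x≤k {x} {k} 2[1+x]≤ =
  s≤s⁻¹ (s<s⁻¹ (*-cancelˡ-< 2 (suc x) (suc (suc k)) (≤-<-trans 2[1+x]≤ (≤-reflexive (2k+3≡ k)))))
  where
  2k+3≡ : ∀ k → suc (2 * k + 3) ≡ 2 * suc (suc k)
  2k+3≡ = solve-∀

smaller-summand≤k : ∀ {x y k} → 2 + (x + y) ≤ 2 * suc x → 2 + (x + y) ≤ 2 * k + 3 → y ≤ k
smaller-summand≤k {x} {y} {k} ≤2[1+x] ≤2k+3 = 2[1+x]≤2k+3⇒x≤k (begin
  2 * suc y    ≡⟨ 2[1+y]≡ y ⟩
  2 + (y + y)  ≤⟨ +-monoʳ-≤ 2 (+-monoˡ-≤ y y≤x) ⟩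
  2 + (x + y)  ≤⟨ ≤2k+3 ⟩
  2 * k + 3    ∎)
  where
  open ≤-Reasoning
  2[1+y]≡ : ∀ y → 2 * suc y ≡ 2 + (y + y)
  2[1+y]≡ = solve-∀
  y≤x : y ≤ x
  y≤x = +-cancelˡ-≤ (2 + x) y x (subst (2 + x + y ≤_) (2[1+x]≡ x) ≤2[1+x])
    where
    2[1+x]≡ : ∀ x → 2 * suc x ≡ 2 + x + x
    2[1+x]≡ = solve-∀

module Residue {t : ℕ} .{{_ : NonZero t}} (r : ℕ) (r<t : r < t) where

  hasResidue : ℕ → Bool
  hasResidue j = does (j % t ≟ r)

  hasResidue⇒≡ : ∀ {j} → hasResidue j ≡ true → j % t ≡ r
  hasResidue⇒≡ {j} h = ≡ᵇ⇒≡ (j % t) r (subst T (sym h) tt)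

  count-first-window : count hasResidue (range 0 t) ≡ 1
  count-first-window = begin
    count hasResidue (range 0 t)                 ≡⟨ cong (count hasResidue ∘ range 0) t≡ ⟩
    count hasResidue (range 0 (r + suc g))       ≡⟨ count-range-split hasResidue r g ⟩
    count hasResidue (range 0 r) + (𝟙 (hasResidue r) + count hasResidue (range (suc r) g))
      ≡⟨ cong₂ (λ c₀ b → c₀ + (𝟙 b + count hasResidue (range (suc r) g)))
               (count-none hasResidue (range 0 r) below-r) (dec-true (r % t ≟ r) (m<n⇒m%n≡m r<t)) ⟩
    suc (count hasResidue (range (suc r) g))     ≡⟨ cong suc (count-none hasResidue (range (suc r) g) above-r) ⟩
    1                                            ∎
    where
    open ≡-Reasoning
    g = proj₁ (m≤n⇒∃[o]m+o≡n r<t)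
    1+r+g≡t : suc r + g ≡ t
    1+r+g≡t = proj₂ (m≤n⇒∃[o]m+o≡n r<t)
    t≡ : t ≡ r + suc g
    t≡ = trans (sym 1+r+g≡t) (sym (+-suc r g))
    ≢r : ∀ {j} → j < t → j ≢ r → hasResidue j ≡ false
    ≢r {j} j<t j≢r = dec-false (j % t ≟ r) (j≢r ∘ trans (sym (m<n⇒m%n≡m j<t)))
    below-r : ∀ {j} → j ∈ range 0 r → hasResidue j ≡ false
    below-r j∈ = ≢r (<-trans j<r r<t) (<⇒≢ j<r)
      where j<r = proj₂ (∈-range⁻ 0 r j∈)
    above-r : ∀ {j} → j ∈ range (suc r) g → hasResidue j ≡ false
    above-r {j} j∈ = ≢r (subst (j <_) 1+r+g≡t (proj₂ (∈-range⁻ (suc r) g j∈))) (>⇒≢ (proj₁ (∈-range⁻ (suc r) g j∈)))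

  count-window : ∀ s → count hasResidue (range s t) ≡ 1
  count-window zero    = count-first-window
  count-window (suc s) = +-cancelˡ-≡ (𝟙 (hasResidue s)) _ _ (begin
    count hasResidue (range s (suc t))                      ≡⟨ cong (count hasResidue) (range-∷ʳ s t) ⟩
    count hasResidue (range s t ∷ʳ (s + t))                 ≡⟨ count-∷ʳ hasResidue (range s t) (s + t) ⟩
    count hasResidue (range s t) + 𝟙 (hasResidue (s + t))
      ≡⟨ cong₂ (λ c m → c + 𝟙 (does (m ≟ r))) (count-window s) ([m+n]%n≡m%n s t) ⟩
    1 + 𝟙 (hasResidue s)                                    ≡⟨ +-comm 1 _ ⟩
    𝟙 (hasResidue s) + 1                                    ∎)
    where open ≡-Reasoning

  count-periods : ∀ s a → count hasResidue (range s (a * t)) ≡ a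
  count-periods s zero    = refl
  count-periods s (suc a) = begin
    count hasResidue (range s (t + a * t))
      ≡⟨ cong (count hasResidue) (range-++ s t (a * t)) ⟩
    count hasResidue (range s t ++ range (s + t) (a * t))
      ≡⟨ count-++ hasResidue (range s t) _ ⟩
    count hasResidue (range s t) + count hasResidue (range (s + t) (a * t))
      ≡⟨ cong₂ _+_ (count-window s) (count-periods (s + t) a) ⟩
    suc a
      ∎
    where open ≡-Reasoning

  multiple-of-period : ∀ {u e} → hasResidue u ≡ true → hasResidue (suc u + e) ≡ true →
                       ∃[ a ] suc e ≡ a * t
  multiple-of-period {u} {e} Ru Rv = v / t ∸ u / t , (begin
    suc e                          ≡⟨ m+n∸m≡n (u / t * t) (suc e) ⟨
    u / t * t + suc e ∸ u / t * t  ≡⟨ cong (_∸ u / t * t) quotients ⟩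
    v / t * t ∸ u / t * t          ≡⟨ *-distribʳ-∸ t (v / t) (u / t) ⟨
    (v / t ∸ u / t) * t            ∎)
    where
    open ≡-Reasoning
    v = suc u + e
    quotients : u / t * t + suc e ≡ v / t * t
    quotients = +-cancelˡ-≡ r _ _ (begin
      r + (u / t * t + suc e)    ≡⟨ +-assoc r (u / t * t) (suc e) ⟨
      r + u / t * t + suc e      ≡⟨ cong (λ c → c + u / t * t + suc e) (hasResidue⇒≡ Ru) ⟨
      u % t + u / t * t + suc e  ≡⟨ cong (_+ suc e) (m≡m%n+[m/n]*n u t) ⟨
      u + suc e                  ≡⟨ +-suc u e ⟩
      v                          ≡⟨ m≡m%n+[m/n]*n v t ⟩
      v % t + v / t * t          ≡⟨ cong (_+ v / t * t) (hasResidue⇒≡ Rv) ⟩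
      r + v / t * t              ∎)

module ResiduePair {t : ℕ} .{{_ : NonZero t}} {r : ℕ} (r<t : r < t) {n k : ℕ} (n≤ : n ≤ (2 * k + 3) * t)
                   (U V : Fin n) {e f : ℕ} (U<V : suc (toℕ U) + e ≡ toℕ V) (V<n : suc (toℕ V) + f ≡ n)
                   (RU : Residue.hasResidue r r<t (toℕ U) ≡ true) (RV : Residue.hasResidue r r<t (toℕ V) ≡ true)
  where

  open Residue r r<t
  open Arcs U V U<V V<n
  open ≤-Reasoning

  private
    cF = count hasResidue forwardArc
    cB = count hasResidue backwardArc
    ℓF = length forwardArc
    ℓB = length backwardArc

    period = multiple-of-period RU (subst (λ j → hasResidue j ≡ true) (sym U<V) RV)
    a = proj₁ period
    1+e≡a*t = proj₂ period

    a≡1+cF : a ≡ suc cF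
    a≡1+cF = begin-equality
      a                                         ≡⟨ count-periods (toℕ U) a ⟨
      count hasResidue (range (toℕ U) (a * t))  ≡⟨ cong (count hasResidue ∘ range (toℕ U)) 1+e≡a*t ⟨
      𝟙 (hasResidue (toℕ U)) + cF               ≡⟨ cong (λ b → 𝟙 b + cF) RU ⟩
      suc cF                                    ∎

    2at≡ : 2 * a * t ≡ 2 + (ℓF + ℓF)
    2at≡ = begin-equality
      2 * a * t      ≡⟨ *-assoc 2 a t ⟩
      2 * (a * t)    ≡⟨ cong (2 *_) 1+e≡a*t ⟨
      2 * suc e      ≡⟨ 2[1+e]≡ e ⟩
      2 + (e + e)    ≡⟨ cong (λ ℓ → 2 + (ℓ + ℓ)) (length-range (suc (toℕ U)) e) ⟨
      2 + (ℓF + ℓF)  ∎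
      where
      2[1+e]≡ : ∀ e → 2 * suc e ≡ 2 + (e + e)
      2[1+e]≡ = solve-∀

    total≡ : count hasResidue (range 0 n) ≡ 2 + (cF + cB)
    total≡ = count-range-around hasResidue RU RV

    total≤ : 2 + (cF + cB) ≤ 2 * k + 3
    total≤ = begin
      2 + (cF + cB)                                 ≡⟨ total≡ ⟨
      count hasResidue (range 0 n)                  ≤⟨ count-range-mono hasResidue 0 n≤ ⟩
      count hasResidue (range 0 ((2 * k + 3) * t))  ≡⟨ count-periods 0 (2 * k + 3) ⟩
      2 * k + 3                                     ∎

  forward-count≤ : length forwardArc ≤ length backwardArc → count hasResidue forwardArc ≤ k
  forward-count≤ F≤B = 2[1+x]≤2k+3⇒x≤k (subst (λ b → 2 * b ≤ 2 * k + 3) a≡1+cF 2a≤)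
    where
    2a≤ : 2 * a ≤ 2 * k + 3
    2a≤ = *-cancelʳ-≤ (2 * a) (2 * k + 3) t (begin
      2 * a * t        ≡⟨ 2at≡ ⟩
      2 + (ℓF + ℓF)    ≤⟨ +-monoʳ-≤ 2 (+-monoʳ-≤ ℓF F≤B) ⟩
      2 + (ℓF + ℓB)    ≡⟨ n≡2+arcs ⟨
      n                ≤⟨ n≤ ⟩
      (2 * k + 3) * t  ∎)

  backward-count≤ : length backwardArc ≤ length forwardArc → count hasResidue backwardArc ≤ k
  backward-count≤ B≤F = smaller-summand≤k total≤2[1+cF] total≤
    where
    n≤2at : n ≤ 2 * a * t
    n≤2at = begin
      n              ≡⟨ n≡2+arcs ⟩
      2 + (ℓF + ℓB)  ≤⟨ +-monoʳ-≤ 2 (+-monoʳ-≤ ℓF B≤F) ⟩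
      2 + (ℓF + ℓF)  ≡⟨ 2at≡ ⟨
      2 * a * t      ∎
    total≤2[1+cF] : 2 + (cF + cB) ≤ 2 * suc cF
    total≤2[1+cF] = begin
      2 + (cF + cB)                           ≡⟨ total≡ ⟨
      count hasResidue (range 0 n)            ≤⟨ count-range-mono hasResidue 0 n≤2at ⟩
      count hasResidue (range 0 (2 * a * t))  ≡⟨ count-periods 0 (2 * a) ⟩
      2 * a                                   ≡⟨ cong (2 *_) a≡1+cF ⟩
      2 * suc cF                              ∎

residue-class-visible : ∀ {n t k} .{{_ : NonZero t}} → n ≤ (2 * k + 3) * t → ∀ {r} (r<t : r < t) →
                        {X : Subset n} → (∀ w → X w ≡ Residue.hasResidue r r<t (toℕ w)) →
                        MutualVisible (Cycle n) X k
residue-class-visible {n} {t} {k} n≤ r<t {X} X≗R = MutualVisible-from-< Cycle-sym visible-pair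
  where
  visible-pair : ∀ {U V} → X U ≡ true → X V ≡ true → toℕ U < toℕ V → Visible (Cycle n) X k U V
  visible-pair {U} {V} XU XV u<v with e , U<V ← m≤n⇒∃[o]m+o≡n u<v | f , V<n ← m≤n⇒∃[o]m+o≡n (toℕ<n V) =
    [ (λ F≤B → visible-forward X≗R F≤B (forward-count≤ F≤B)) ,
      (λ B≤F → Visible-sym Cycle-sym (visible-backward X≗R B≤F (backward-count≤ B≤F))) ]′
      (≤-total (length forwardArc) (length backwardArc))
    where
    open Arcs U V U<V V<n
    open ResiduePair r<t {k = k} n≤ U V U<V V<n (trans (sym (X≗R U)) XU) (trans (sym (X≗R V)) XV)

residue-cover : ∀ {n t k} .{{_ : NonZero t}} → t ≤ n → n ≤ (2 * k + 3) * t →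
                IsCover (Cycle n) k t (λ v → toℕ v mod t)
residue-cover {n} {t} {k} t≤n n≤ = surjective , λ i → residue-class-visible n≤ (toℕ<n i) (part≗ i)
  where
  toℕ-mod : ∀ j → toℕ (j mod t) ≡ j % t
  toℕ-mod j = toℕ-fromℕ< (m%n<n j t)
  surjective : (i : Fin t) → ∃ λ v → toℕ v mod t ≡ i
  surjective i = v , toℕ-injective (begin
    toℕ (toℕ v mod t)  ≡⟨ toℕ-mod (toℕ v) ⟩
    toℕ v % t          ≡⟨ cong (_% t) (toℕ-fromℕ< i<n) ⟩
    toℕ i % t          ≡⟨ m<n⇒m%n≡m (toℕ<n i) ⟩
    toℕ i              ∎)
    where
    open ≡-Reasoning
    i<n = <-≤-trans (toℕ<n i) t≤n
    v = fromℕ< i<n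
  part≗ : ∀ i w → part (λ v → toℕ v mod t) i w ≡ Residue.hasResidue (toℕ i) (toℕ<n i) (toℕ w)
  part≗ i w = trans (part-does _ i w)
                    (does-⇔ (mk⇔ (λ eq → trans (sym (toℕ-mod (toℕ w))) (cong toℕ eq))
                                 (λ eq → toℕ-injective (trans (toℕ-mod (toℕ w)) eq)))
                            (toℕ w mod t Fin.≟ i) (toℕ w % t ≟ toℕ i))

-- Ceiling division and the theorem

m≤⌈m/n⌉*n : ∀ m n .{{_ : NonZero n}} → m ≤ ⌈ m / n ⌉ * n
m≤⌈m/n⌉*n m (suc b) = +-cancelʳ-≤ b m (q * suc b) (begin
  m + b                        ≡⟨ m≡m%n+[m/n]*n (m + b) (suc b) ⟩
  (m + b) % suc b + q * suc b  ≤⟨ +-monoˡ-≤ (q * suc b) (s≤s⁻¹ (m%n<n (m + b) (suc b))) ⟩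
  b + q * suc b                ≡⟨ +-comm b (q * suc b) ⟩
  q * suc b + b                ∎)
  where
  open ≤-Reasoning
  q = (m + b) / suc b

m≤o*n⇒⌈m/n⌉≤o : ∀ m n o .{{_ : NonZero n}} → m ≤ o * n → ⌈ m / n ⌉ ≤ o
m≤o*n⇒⌈m/n⌉≤o m (suc b) o m≤o*n = s≤s⁻¹ (m<n*o⇒m/o<n (begin-strict
  m + b              <⟨ +-monoʳ-< m (n<1+n b) ⟩
  m + suc b          ≤⟨ +-monoˡ-≤ (suc b) m≤o*n ⟩
  o * suc b + suc b  ≡⟨ +-comm (o * suc b) (suc b) ⟩
  suc o * suc b      ∎))
  where open ≤-Reasoning

proposition8p9 : (n k : ℕ) → 3 ≤ n →
    TauIs (Cycle n) k ⌈ n / (n ⊓ (2 * k + 3)) ⌉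
proposition8p9 n k 3≤n =
  ((λ v → toℕ v mod t) , residue-cover t≤n n≤[2k+3]t) ,
  λ m c cover → m≤o*n⇒⌈m/n⌉≤o n D m (cover⇒n≤m*[n⊓[2k+3]] 0<n cover)
  where
  D = n ⊓ (2 * k + 3)
  0<n : 0 < n
  0<n = ≤-trans (s≤s z≤n) 3≤n
  instance
    D-nonZero : NonZero D
    D-nonZero = >-nonZero (⊓-glb 0<n (≤-trans (s≤s z≤n) (m≤n+m 3 (2 * k))))
  t = ⌈ n / D ⌉
  n≤tD : n ≤ t * D
  n≤tD = m≤⌈m/n⌉*n n D
  instance
    t-nonZero : NonZero t
    t-nonZero = ≢-nonZero (λ t≡0 → <⇒≱ 0<n (subst (λ x → n ≤ x * D) t≡0 n≤tD))
  t≤n : t ≤ n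
  t≤n = m≤o*n⇒⌈m/n⌉≤o n D n (m≤m*n n D)
  n≤[2k+3]t : n ≤ (2 * k + 3) * t
  n≤[2k+3]t = ≤-trans n≤tD (≤-trans (*-monoʳ-≤ t (m⊓n≤n n (2 * k + 3))) (≤-reflexive (*-comm t (2 * k + 3))))
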